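{- The category $\mathsf{SPxJLat}$ of strong proximity $\vee$-semilattices and join-approximable relations is equivalent to the category $\mathrm{CoAlg}(\mathrm{P_L})$ of coalgebras of the lower powerlocale comonad $\mathrm{P_L}$ on $\mathsf{PxPos}$ (with coalgebra homomorphisms as morphisms).
   Context: Work constructively; for a set $S$, $\mathrm{Fin}(S)$ is the set of finitely enumerable subsets of $S$. For a relation $r\subseteq X\times Y$, $x\in X$, $y\in Y$, write $rx=\{y\mid x\,r\,y\}$ and $r^{ - }y=\{x\mid x\,r\,y\}$. An ideal of a poset $(S,\le)$ is a downward closed, inhabited subset in which any two elements have an upper bound in it. A proximity poset is $(S,\le,\prec)$ with $(S,\le)$ a poset and $\prec$ a relation on $S$ such that for every $a\in S$: $\{b\mid b\prec a\}$ is an ideal $I$ that is rounded ($x\in I\iff\exists y\,(x\prec y\ \&\ y\in I)$), and $\{b\mid a\prec b\}$ is an upward closed set $U$ that is rounded ($x\in U\iff \exists y\,(y\prec x\ \&\ y\in U)$). An approximable relation between proximity posets $(S,\prec)\to(S',\prec')$ is $r\subseteq S\times S'$ such that $r^{ - }b$ is a rounded ideal of $S$ for every $b\in S'$ and $ra$ is a rounded upward closed subset of $S'$ for every $a\in S$. $\mathsf{PxPos}$ is the category of proximity posets and approximable relations; the identity on $(S,\prec)$ is $\prec$, and composition $s\circ r$ is relational composition ($a\,(s\circ r)\,c$ iff $\exists b\,(a\,r\,b\ \&\ b\,s\,c)$). A proximity $\vee$-semilattice is a proximity poset whose underlying poset is a join-semilattice $(S,0,\vee)$. It is strong if (i) $a\prec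 0\Rightarrow a=0$ and (ii) $a\prec b\vee c\Rightarrow \exists b',c'\,(a\le b'\vee c'\ \&\ b'\prec b\ \&\ c'\prec c)$. An approximable relation $r$ between proximity $\vee$-semilattices $(S,0,\vee,\prec)\to(S',0',\vee',\prec')$ is join-approximable if $a\,r\,0'\Rightarrow a=0$ and $a\,r\,(b\vee' c)\Rightarrow\exists b',c'\in S\,(a\le b'\vee c'\ \&\ b'\,r\,b\ \&\ c'\,r\,c)$. $\mathsf{SPxJLat}$ has strong proximity $\vee$-semilattices as objects and join-approximable relations as morphisms (identities and composition as in $\mathsf{PxPos}$). For $r\subseteq S\times S'$ its lower extension $r_L\subseteq\mathrm{Fin}(S)\times\mathrm{Fin}(S')$ is $A\,r_L\,B\iff\forall a\in A\,\exists b\in B\,(a\,r\,b)$. The lower powerlocale of a proximity poset $(S,\le,\prec)$ is $\mathrm{P_L}(S)=((\mathrm{Fin}(S),\le_L),\prec_L)$, where $(\mathrm{Fin}(S),\le_L)$ means the poset reflection of the preorder $\le_L$. This gives a comonad on $\mathsf{PxPos}$: $\mathrm{P_L}(r)=r_L$, counit $\varepsilon^L_S:\mathrm{P_L}(S)\to S$ given by $A\,\varepsilon^L_S\,a\iff A\prec_L\{a\}$, comultiplication $\nu^L_S:\mathrm{P_L}(S)\to\mathrm{P_L}\mathrm{P_L}(S)$ given by $A\,\nu^L_S\,\mathcal U\iff A\prec_L\bigcup\mathcal U$. A coalgebra of a comonad $(T,\varepsilon,\nu)$ is a morphism $\alpha:X\to TX$ with $\varepsilon_X\circ\alpha=\mathrm{id}_X$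 and $\nu_X\circ\alpha=T\alpha\circ\alpha$; a homomorphism $(X,\alpha)\to(Y,\beta)$ is $f:X\to Y$ with $\beta\circ f=Tf\circ\alpha$. -}

module Defs where

open import Level using (0ℓ)
open import Data.Product using (Σ; Σ-syntax; ∃; ∃-syntax; ∃₂; _×_; _,_; proj₁; proj₂)
open import Data.List using (List; []; _∷_; [_]; concat)
open import Data.List.Membership.Propositional using (_∈_)
open import Data.List.Relation.Unary.Any using (here; there)
open import Algebra.Core using (Op₂)
open import Relation.Binary using (Rel; IsPartialOrder; IsEquivalence)
open import Relation.Binary.Lattice using (IsBoundedJoinSemilattice)
open import Relation.Binary.PropositionalEquality using (_≡_; refl)

Relation : Set → Set → Set₁
Relation X Y = X → Y → Set

_⊆R_ : ∀ {X Y} → Relation X Y → Relation X Y → Set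
r ⊆R s = ∀ {x y} → r x y → s x y

_≃R_ : ∀ {X Y} → Relation X Y → Relation X Y → Set
r ≃R s = (r ⊆R s) × (s ⊆R r)

_⊙_ : ∀ {X Y Z} → Relation Y Z → Relation X Y → Relation X Z
(s ⊙ r) x z = ∃[ y ] (r x y × s y z)

module _ {S : Set} (_≤_ : Rel S 0ℓ) where

  IsDownClosed : (S → Set) → Set
  IsDownClosed I = ∀ {x y} → x ≤ y → I y → I x

  IsUpClosed : (S → Set) → Set
  IsUpClosed U = ∀ {x y} → x ≤ y → U x → U y

  IsIdeal : (S → Set) → Set
  IsIdeal I = IsDownClosed I × (∃[ x ] I x)
            × (∀ {x y} → I x → I y → ∃[ z ] (I z × x ≤ z × y ≤ z))

module _ {S : Set} (_≤_ _≺_ : Rel S 0ℓ) where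

  IsRoundedIdeal : (S → Set) → Set
  IsRoundedIdeal I = IsIdeal _≤_ I
    × (∀ x → (I x → ∃[ y ] (x ≺ y × I y)) × (∃[ y ] (x ≺ y × I y) → I x))

  IsRoundedUpper : (S → Set) → Set
  IsRoundedUpper U = IsUpClosed _≤_ U
    × (∀ x → (U x → ∃[ y ] (y ≺ x × U y)) × (∃[ y ] (y ≺ x × U y) → U x))

record ProximityPoset : Set₁ where
  field
    Carrier        : Set
    _≈_            : Rel Carrier 0ℓ
    _≤_            : Rel Carrier 0ℓ
    _≺_            : Rel Carrier 0ℓ
    isPartialOrder : IsPartialOrder _≈_ _≤_
    ≺-lower        : ∀ a → IsRoundedIdeal _≤_ _≺_ (λ b → b ≺ a)
    ≺-upper        : ∀ a → IsRoundedUpper _≤_ _≺_ (λ b → a ≺ b)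

∣_∣ : ProximityPoset → Set
∣ S ∣ = ProximityPoset.Carrier S

-- approximable relations, stated for raw data (carrier, ≤, ≺) on both sides
IsApproximable′ : ∀ {S S′ : Set} (_≤_ _≺_ : Rel S 0ℓ) (_≤′_ _≺′_ : Rel S′ 0ℓ)
                → Relation S S′ → Set
IsApproximable′ _≤_ _≺_ _≤′_ _≺′_ r =
    (∀ b → IsRoundedIdeal _≤_ _≺_ (λ a → r a b))
  × (∀ a → IsRoundedUpper _≤′_ _≺′_ (r a))

IsApproximable : (S S′ : ProximityPoset) → Relation ∣ S ∣ ∣ S′ ∣ → Set
IsApproximable S S′ = IsApproximable′ (ProximityPoset._≤_ S) (ProximityPoset._≺_ S)
                                      (ProximityPoset._≤_ S′) (ProximityPoset._≺_ S′)

-- Lower extension and the lower powerlocale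
-- Fin(S) is represented by lists (finite enumerations); the poset
-- reflection of ≤_L is left implicit: everything below is ≤_L-invariant.

LowerExt : ∀ {X Y} → Relation X Y → Relation (List X) (List Y)
LowerExt r A B = ∀ a → a ∈ A → ∃[ b ] (b ∈ B × r a b)

module PL (S : ProximityPoset) where
  open ProximityPoset S

  _≤L_ : Rel (List Carrier) 0ℓ
  _≤L_ = LowerExt _≤_

  _≺L_ : Rel (List Carrier) 0ℓ
  _≺L_ = LowerExt _≺_

  _≤LL_ : Rel (List (List Carrier)) 0ℓ
  _≤LL_ = LowerExt _≤L_

  _≺LL_ : Rel (List (List Carrier)) 0ℓ
  _≺LL_ = LowerExt _≺L_

  ε : Relation (List Carrier) Carrier
  ε A a = A ≺L [ a ]

  ν : Relation (List Carrier) (List (List Carrier))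
  ν A 𝒰 = A ≺L concat 𝒰

record Category : Set₂ where
  infixr 9 _∘_
  infix  4 _≈_
  field
    Obj       : Set₁
    Hom       : Obj → Obj → Set₁
    _≈_       : ∀ {A B} → Rel (Hom A B) 0ℓ
    id        : ∀ {A} → Hom A A
    _∘_       : ∀ {A B C} → Hom B C → Hom A B → Hom A C
    ≈-equiv   : ∀ {A B} → IsEquivalence (_≈_ {A} {B})
    ∘-resp-≈  : ∀ {A B C} {f h : Hom B C} {g i : Hom A B}
              → f ≈ h → g ≈ i → f ∘ g ≈ h ∘ i
    assoc     : ∀ {A B C D} {f : Hom A B} {g : Hom B C} {h : Hom C D}
              → (h ∘ g) ∘ f ≈ h ∘ (g ∘ f)
    identityˡ : ∀ {A B} {f : Hom A B} → id ∘ f ≈ f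
    identityʳ : ∀ {A B} {f : Hom A B} → f ∘ id ≈ f

open Category using (Obj; Hom)

record Functor (C D : Category) : Set₁ where
  private
    module C = Category C
    module D = Category D
  field
    F₀     : C.Obj → D.Obj
    F₁     : ∀ {A B} → C.Hom A B → D.Hom (F₀ A) (F₀ B)
    F-resp : ∀ {A B} {f g : C.Hom A B} → f C.≈ g → F₁ f D.≈ F₁ g
    F-id   : ∀ {A} → F₁ (C.id {A}) D.≈ D.id
    F-∘    : ∀ {A B E} {f : C.Hom A B} {g : C.Hom B E}
           → F₁ (g C.∘ f) D.≈ F₁ g D.∘ F₁ f

idF : ∀ {C} → Functor C C
idF {C} = record
  { F₀ = λ A → A ; F₁ = λ f → f ; F-resp = λ p → p
  ; F-id = IsEquivalence.refl (Category.≈-equiv C)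
  ; F-∘ = IsEquivalence.refl (Category.≈-equiv C) }

_∘F_ : ∀ {C D E} → Functor D E → Functor C D → Functor C E
_∘F_ {C} {D} {E} G F = record
  { F₀ = λ A → G.F₀ (F.F₀ A)
  ; F₁ = λ f → G.F₁ (F.F₁ f)
  ; F-resp = λ p → G.F-resp (F.F-resp p)
  ; F-id = IsEquivalence.trans (Category.≈-equiv E) (G.F-resp F.F-id) G.F-id
  ; F-∘ = IsEquivalence.trans (Category.≈-equiv E) (G.F-resp F.F-∘) G.F-∘ }
  where
    module F = Functor F
    module G = Functor G

record NaturalIsomorphism {C D : Category} (F G : Functor C D) : Set₁ where
  private
    module C = Category C
    module D = Category D
    module F = Functor F
    module G = Functor G
  field
    η       : ∀ A → D.Hom (F.F₀ A) (G.F₀ A)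
    η⁻¹     : ∀ A → D.Hom (G.F₀ A) (F.F₀ A)
    isoˡ    : ∀ A → η⁻¹ A D.∘ η A D.≈ D.id
    isoʳ    : ∀ A → η A D.∘ η⁻¹ A D.≈ D.id
    natural : ∀ {A B} (f : C.Hom A B) → η B D.∘ F.F₁ f D.≈ G.F₁ f D.∘ η A

record Equivalence (C D : Category) : Set₁ where
  field
    F      : Functor C D
    G      : Functor D C
    unit   : NaturalIsomorphism (idF {C}) (G ∘F F)
    counit : NaturalIsomorphism (F ∘F G) (idF {D})

module _ {X Y : Set} where
  ≃R-equiv : IsEquivalence (_≃R_ {X} {Y})
  ≃R-equiv = record
    { refl  = (λ p → p) , (λ p → p)
    ; sym   = λ (f , g) → g , f
    ; trans = λ (f , g) (h , k) → (λ p → h (f p)) , (λ p → g (k p)) }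

⊙-assoc : ∀ {X Y Z W} {f : Relation X Y} {g : Relation Y Z} {h : Relation Z W}
        → ((h ⊙ g) ⊙ f) ≃R (h ⊙ (g ⊙ f))
⊙-assoc = (λ (y , fy , (z , gz , hz)) → z , (y , fy , gz) , hz)
        , (λ (z , (y , fy , gz) , hz) → y , fy , (z , gz , hz))

⊙-resp : ∀ {X Y Z} {f h : Relation Y Z} {g i : Relation X Y}
       → f ≃R h → g ≃R i → (f ⊙ g) ≃R (h ⊙ i)
⊙-resp (f⊆h , h⊆f) (g⊆i , i⊆g) =
    (λ (y , p , q) → y , g⊆i p , f⊆h q)
  , (λ (y , p , q) → y , i⊆g p , h⊆f q)

module _ {S S′ : Set} {_≤_ _≺_ : Rel S 0ℓ} {_≤′_ _≺′_ : Rel S′ 0ℓ} {r : Relation S S′}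
         (ap : IsApproximable′ _≤_ _≺_ _≤′_ _≺′_ r) where

  approx-idʳ : (r ⊙ _≺_) ≃R r
  approx-idʳ = (λ {a} {b} (y , a≺y , ryb) → proj₂ (proj₂ (proj₁ ap b) a) (y , a≺y , ryb))
             , (λ {a} {b} rab → proj₁ (proj₂ (proj₁ ap b) a) rab)

  approx-idˡ : (_≺′_ ⊙ r) ≃R r
  approx-idˡ = (λ {a} {b} (y , ray , y≺b) → proj₂ (proj₂ (proj₂ ap a) b) (y , y≺b , ray))
             , (λ {a} {b} rab → let (y , y≺b , ray) = proj₁ (proj₂ (proj₂ ap a) b) rab
                                in y , ray , y≺b)

approx-∘ : ∀ {S S′ S″ : Set} {_≤_ _≺_ : Rel S 0ℓ} {_≤′_ _≺′_ : Rel S′ 0ℓ}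
             {_≤″_ _≺″_ : Rel S″ 0ℓ} {r : Relation S S′} {s : Relation S′ S″}
         → IsApproximable′ _≤_ _≺_ _≤′_ _≺′_ r
         → IsApproximable′ _≤′_ _≺′_ _≤″_ _≺″_ s
         → IsApproximable′ _≤_ _≺_ _≤″_ _≺″_ (s ⊙ r)
approx-∘ {S} {S′} {S″} {_≤_} {_≺_} {_≤′_} {_≺′_} {_≤″_} {_≺″_} {r} {s} (rL , rU) (sL , sU) = lower , upper
  where
  lower : ∀ c → _
  lower c = (((λ {x} {y} → down {x} {y}) , inh , (λ {x} {y} → dir {x} {y})) , rnd)
    where
    I : S → Set
    I a = (s ⊙ r) a c
    down : IsDownClosed _≤_ I
    down = λ x≤y (b , ryb , sbc) → b , proj₁ (proj₁ (rL b)) x≤y ryb , sbc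
    inh = let (b₀ , sb₀c) = proj₁ (proj₂ (proj₁ (sL c)))
              (a , rab₀) = proj₁ (proj₂ (proj₁ (rL b₀)))
          in a , b₀ , rab₀ , sb₀c
    dir : ∀ {x y} → I x → I y → ∃[ z ] (I z × x ≤ z × y ≤ z)
    dir {a₁} {a₂} (b₁ , r₁ , s₁) (b₂ , r₂ , s₂) =
            let (b , sbc , b₁≤b , b₂≤b) = proj₂ (proj₂ (proj₁ (sL c))) s₁ s₂
                (a , rab , a₁≤a , a₂≤a) = proj₂ (proj₂ (proj₁ (rL b)))
                                            (proj₁ (rU a₁) b₁≤b r₁) (proj₁ (rU a₂) b₂≤b r₂)
            in a , (b , rab , sbc) , a₁≤a , a₂≤a
    rnd = λ a → (λ (b , rab , sbc) → let (y , a≺y , ryb) = proj₁ (proj₂ (rL b) a) rab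
                                     in y , a≺y , (b , ryb , sbc))
              , (λ (y , a≺y , (b , ryb , sbc)) → b , proj₂ (proj₂ (rL b) a) (y , a≺y , ryb) , sbc)
  upper : ∀ a → _
  upper a = (λ {x} {y} → up {x} {y}) , rnd
    where
    up : IsUpClosed _≤″_ ((s ⊙ r) a)
    up = λ c≤c′ (b , rab , sbc) → b , rab , proj₁ (sU b) c≤c′ sbc
    rnd = λ c → (λ (b , rab , sbc) → let (y , y≺c , sby) = proj₁ (proj₂ (sU b) c) sbc
                                     in y , y≺c , (b , rab , sby))
              , (λ (y , y≺c , (b , rab , sby)) → b , rab , proj₂ (proj₂ (sU b) c) (y , y≺c , sby))

LowerExt-⊙ : ∀ {X Y Z} {f : Relation X Y} {g : Relation Y Z}
           → (LowerExt g ⊙ LowerExt f) ≃R LowerExt (g ⊙ f)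
LowerExt-⊙ {f = f} {g} = to , from
  where
  to : ∀ {A C} → (LowerExt g ⊙ LowerExt f) A C → LowerExt (g ⊙ f) A C
  to (B , fAB , gBC) a a∈A =
    let (b , b∈B , fab) = fAB a a∈A
        (c , c∈C , gbc) = gBC b b∈B
    in c , c∈C , (b , fab , gbc)
  from : ∀ {A C} → LowerExt (g ⊙ f) A C → (LowerExt g ⊙ LowerExt f) A C
  from {[]} h = [] , (λ _ ()) , (λ _ ())
  from {a ∷ A} h =
    let (c , c∈C , (b , fab , gbc)) = h a (here refl)
        (B , fAB , gBC) = from {A} (λ x x∈A → h x (there x∈A))
        fAB′ : LowerExt f (a ∷ A) (b ∷ B)
        fAB′ = λ { _ (here refl) → b , here refl , fab
                 ; x (there x∈A) → let (y , y∈B , fxy) = fAB x x∈A in y , there y∈B , fxy }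
        gBC′ : LowerExt g (b ∷ B) _
        gBC′ = λ { _ (here refl) → c , c∈C , gbc
                 ; y (there y∈B) → gBC y y∈B }
    in b ∷ B , fAB′ , gBC′

module RelCat (O : Set₁) (U : O → ProximityPoset)
  (IsHom : (A B : O) → Relation ∣ U A ∣ ∣ U B ∣ → Set)
  (hom-approx : ∀ {A B r} → IsHom A B r → IsApproximable (U A) (U B) r)
  (id-hom : ∀ {A} → IsHom A A (ProximityPoset._≺_ (U A)))
  (∘-hom : ∀ {A B C r s} → IsHom A B r → IsHom B C s → IsHom A C (s ⊙ r)) where

  RHom : O → O → Set₁
  RHom A B = Σ (Relation ∣ U A ∣ ∣ U B ∣) (IsHom A B)

  cat : Category
  cat = record
    { Obj = O
    ; Hom = RHom
    ; _≈_ = λ f g → proj₁ f ≃R proj₁ g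
    ; id = λ {A} → ProximityPoset._≺_ (U A) , id-hom
    ; _∘_ = λ (s , hs) (r , hr) → s ⊙ r , ∘-hom hr hs
    ; ≈-equiv = record
        { refl = IsEquivalence.refl ≃R-equiv
        ; sym = IsEquivalence.sym ≃R-equiv
        ; trans = IsEquivalence.trans ≃R-equiv }
    ; ∘-resp-≈ = ⊙-resp
    ; assoc = ⊙-assoc
    ; identityˡ = λ {A} {B} {f} → approx-idˡ (hom-approx (proj₂ f))
    ; identityʳ = λ {A} {B} {f} → approx-idʳ (hom-approx (proj₂ f))
    }

PxPos : Category
PxPos = RelCat.cat ProximityPoset (λ S → S) IsApproximable (λ p → p)
          (λ {A} → (λ b → ProximityPoset.≺-lower A b) , (λ a → ProximityPoset.≺-upper A a))
          approx-∘

record StrongProximityJoinSemilattice : Set₁ where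
  field
    px       : ProximityPoset
    𝟘        : ProximityPoset.Carrier px
    _∨_      : Op₂ (ProximityPoset.Carrier px)
    isBoundedJoinSemilattice :
      IsBoundedJoinSemilattice (ProximityPoset._≈_ px) (ProximityPoset._≤_ px) _∨_ 𝟘
    strong-𝟘 : ∀ {a} → ProximityPoset._≺_ px a 𝟘 → ProximityPoset._≈_ px a 𝟘
    strong-∨ : ∀ {a b c} → ProximityPoset._≺_ px a (b ∨ c)
             → ∃₂ λ b′ c′ → ProximityPoset._≤_ px a (b′ ∨ c′)
                          × ProximityPoset._≺_ px b′ b × ProximityPoset._≺_ px c′ c

module _ (S T : StrongProximityJoinSemilattice) where
  private
    module S = StrongProximityJoinSemilattice S
    module T = StrongProximityJoinSemilattice T
    module SP = ProximityPoset S.px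

  IsJoinApproximable : Relation ∣ S.px ∣ ∣ T.px ∣ → Set
  IsJoinApproximable r =
      (∀ {a} → r a T.𝟘 → a SP.≈ S.𝟘)
    × (∀ {a b c} → r a (b T.∨ c) → ∃₂ λ b′ c′ → a SP.≤ (b′ S.∨ c′) × r b′ b × r c′ c)

  IsSPxJLatHom : Relation ∣ S.px ∣ ∣ T.px ∣ → Set
  IsSPxJLatHom r = IsApproximable S.px T.px r × IsJoinApproximable r

private
  module SPJ = StrongProximityJoinSemilattice

  spj-id : ∀ {S} → IsSPxJLatHom S S (ProximityPoset._≺_ (SPJ.px S))
  spj-id {S} = ((λ b → ProximityPoset.≺-lower (SPJ.px S) b) , (λ a → ProximityPoset.≺-upper (SPJ.px S) a))
             , SPJ.strong-𝟘 S , SPJ.strong-∨ S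

  spj-∘ : ∀ {S T V r s} → IsSPxJLatHom S T r → IsSPxJLatHom T V s → IsSPxJLatHom S V (s ⊙ r)
  spj-∘ {S} {T} {V} {r} {s} (rA , r𝟘 , r∨) (sA , s𝟘 , s∨) = approx-∘ rA sA , z , j
    where
    module TP = ProximityPoset (SPJ.px T)
    z : ∀ {a} → (s ⊙ r) a (SPJ.𝟘 V) → _
    z (b , rab , sb0) = r𝟘 (proj₁ (proj₂ rA _) (IsPartialOrder.reflexive TP.isPartialOrder (s𝟘 sb0)) rab)
    j : ∀ {a b c} → (s ⊙ r) a (SPJ._∨_ V b c) → _
    j (b , rab , sbcd) =
      let (c′ , d′ , b≤ , sc′ , sd′) = s∨ sbcd
          (c″ , d″ , a≤ , rc″ , rd″) = r∨ (proj₁ (proj₂ rA _) b≤ rab)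
      in c″ , d″ , a≤ , (c′ , rc″ , sc′) , (d′ , rd″ , sd′)

SPxJLat : Category
SPxJLat = RelCat.cat StrongProximityJoinSemilattice SPJ.px IsSPxJLatHom proj₁
            (λ {A} → spj-id {A}) (λ {A} {B} {C} → spj-∘ {A} {B} {C})

record PLCoalgebra : Set₁ where
  field
    X        : ProximityPoset
    α        : Relation ∣ X ∣ (List ∣ X ∣)
    α-approx : IsApproximable′ (ProximityPoset._≤_ X) (ProximityPoset._≺_ X)
                               (PL._≤L_ X) (PL._≺L_ X) α
    counit   : (PL.ε X ⊙ α) ≃R ProximityPoset._≺_ X
    comult   : (PL.ν X ⊙ α) ≃R (LowerExt α ⊙ α)

module _ (A B : PLCoalgebra) where
  private
    module A = PLCoalgebra A
    module B = PLCoalgebra B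

  IsCoalgHom : Relation ∣ A.X ∣ ∣ B.X ∣ → Set
  IsCoalgHom f = IsApproximable A.X B.X f × ((B.α ⊙ f) ≃R (LowerExt f ⊙ A.α))

private
  module CA = PLCoalgebra
  ≃-trans : ∀ {X Y} {r s t : Relation X Y} → r ≃R s → s ≃R t → r ≃R t
  ≃-trans = IsEquivalence.trans ≃R-equiv
  ≃-sym : ∀ {X Y} {r s : Relation X Y} → r ≃R s → s ≃R r
  ≃-sym = IsEquivalence.sym ≃R-equiv
  ≃-refl : ∀ {X Y} {r : Relation X Y} → r ≃R r
  ≃-refl = IsEquivalence.refl ≃R-equiv

  coalg-id : ∀ {A} → IsCoalgHom A A (ProximityPoset._≺_ (CA.X A))
  coalg-id {A} = ((λ b → ProximityPoset.≺-lower (CA.X A) b) , (λ a → ProximityPoset.≺-upper (CA.X A) a))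
               , ≃-trans (approx-idʳ (CA.α-approx A)) (≃-sym (approx-idˡ (CA.α-approx A)))

  coalg-∘ : ∀ {A B C f g} → IsCoalgHom A B f → IsCoalgHom B C g → IsCoalgHom A C (g ⊙ f)
  coalg-∘ {A} {B} {C} {f} {g} (fA , hf) (gA , hg) = approx-∘ fA gA ,
    ≃-trans (≃-sym (⊙-assoc {f = f} {g} {CA.α C}))
    (≃-trans (⊙-resp hg (≃-refl {r = f}))
    (≃-trans (⊙-assoc {f = f} {CA.α B} {LowerExt g})
    (≃-trans (⊙-resp (≃-refl {r = LowerExt g}) hf)
    (≃-trans (≃-sym (⊙-assoc {f = CA.α A} {LowerExt f} {LowerExt g}))
             (⊙-resp (LowerExt-⊙ {f = f} {g}) (≃-refl {r = CA.α A}))))))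

CoAlgPL : Category
CoAlgPL = RelCat.cat PLCoalgebra CA.X IsCoalgHom proj₁
            (λ {A} → coalg-id {A}) (λ {A} {B} {C} → coalg-∘ {A} {B} {C})

module Submission where

open import Defs
open import Level using (0ℓ)
open import Data.Product using (∃-syntax; ∃₂; _×_; _,_; proj₁; proj₂)
open import Data.Sum using (inj₁; inj₂; [_,_]′)
open import Data.List using (List; []; _∷_; [_]; _++_; foldr; map; concat)
open import Data.List.Properties using (++-identityʳ; concat-map-[_])
open import Data.List.Membership.Propositional using (_∈_)
open import Data.List.Membership.Propositional.Properties
  using (∈-++⁺ʳ; ∈-++⁻; ∈-concat⁺′; ∈-concat⁻′; ∈-map⁻)
open import Data.List.Relation.Unary.Any using (here; there)
open import Data.List.Relation.Binary.Subset.Propositional using (_⊆_)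
open import Data.List.Relation.Binary.Subset.Propositional.Properties
  using (xs⊆xs++ys; xs⊆ys++xs; xs⊆x∷xs; ∷⁺ʳ; ∈-∷⁺ʳ; ++⁺ʳ)
open import Relation.Binary using (Rel; Transitive; IsPartialOrder)
open import Relation.Binary.Lattice using (IsBoundedJoinSemilattice)
open import Relation.Binary.PropositionalEquality using (refl; sym; subst)

-- A strong proximity ∨-semilattice S becomes a P_L-coalgebra via  a α A ⇔ a ≺ ⋁A;
-- strongness is exactly what lets a ≺ ⋁A be refined to a ≺_L-smaller list, which makes
-- α approximable and coassociative.  Conversely, for a coalgebra (X, α) the counit law
-- says that α restricted to singletons is ≺, and the comultiplication law gives a cut
-- rule (α x E and α e B for all e ∈ E imply α x B).  With these two facts the finite
-- subsets of X, preordered by A ≤ B ⇔ α⁻A ⊆ α⁻B, with join _++_ and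
-- A ≺ B ⇔ A ≤ C for some C with α c B for all c ∈ C, form a strong proximity
-- ∨-semilattice G(X, α).  The unit S ≅ G(F S) is α itself, a ↦ {A | a ≺ ⋁A}, and the
-- counit F(G X) ≅ X is A ↦ {b | A ≺ [ b ]}, again with inverse α.

LowerExt-∷⁺ : ∀ {X Y} {R : Relation X Y} {a b A B}
            → b ∈ B → R a b → LowerExt R A B → LowerExt R (a ∷ A) B
LowerExt-∷⁺ b∈B Rab RAB _ (here refl) = _ , b∈B , Rab
LowerExt-∷⁺ b∈B Rab RAB x (there x∈A) = RAB x x∈A

LowerExt-⊆ʳ : ∀ {X Y} {R : Relation X Y} {A B B′} → B ⊆ B′ → LowerExt R A B → LowerExt R A B′
LowerExt-⊆ʳ B⊆B′ RAB a a∈A = let (b , b∈B , Rab) = RAB a a∈A in b , B⊆B′ b∈B , Rab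

LowerExt-singleton⁺ : ∀ {X Y} {R : Relation X Y} {a b} → R a b → LowerExt R [ a ] [ b ]
LowerExt-singleton⁺ Rab _ (here refl) = _ , here refl , Rab

LowerExt-singleton⁻ : ∀ {X Y} {R : Relation X Y} {A b} → LowerExt R A [ b ] → ∀ a → a ∈ A → R a b
LowerExt-singleton⁻ RAb a a∈A with RAb a a∈A
... | _ , here refl , Rab = Rab

LowerExt-[]⁻ : ∀ {X Y} {R : Relation X Y} {A} → LowerExt R A [] → A ⊆ []
LowerExt-[]⁻ RA[] {a} a∈A with RA[] a a∈A
... | _ , () , _

all-singleton : ∀ {X : Set} {P : X → Set} {y} → P y → ∀ z → z ∈ [ y ] → P z
all-singleton Py _ (here refl) = Py

-- Finite choice, with the chosen witness lists concatenated.
collect : ∀ {X Y : Set} (P : X → List Y → Set) (Q : Y → Set)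
        → (∀ {c L M} → P c L → L ⊆ M → P c M)
        → (C : List X)
        → (∀ c → c ∈ C → ∃[ L ] (P c L × (∀ y → y ∈ L → Q y)))
        → ∃[ M ] ((∀ c → c ∈ C → P c M) × (∀ y → y ∈ M → Q y))
collect P Q mono [] h = [] , (λ _ ()) , (λ _ ())
collect P Q mono (c ∷ C) h
  with h c (here refl) | collect P Q mono C (λ c′ m → h c′ (there m))
... | L , PcL , QL | M , PCM , QM = L ++ M , PcCLM , QLM
  where
  PcCLM : ∀ c′ → c′ ∈ c ∷ C → P c′ (L ++ M)
  PcCLM _ (here refl) = mono PcL (xs⊆xs++ys L M)
  PcCLM c′ (there m) = mono (PCM c′ m) (xs⊆ys++xs M L)
  QLM : ∀ y → y ∈ L ++ M → Q y
  QLM y m = [ QL y , QM y ]′ (∈-++⁻ L m)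

LowerExt-++⁻ : ∀ {X Y} {R : Relation X Y} (B B′ : List Y) (E : List X)
             → LowerExt R E (B ++ B′)
             → ∃₂ λ D D′ → E ⊆ D ++ D′ × LowerExt R D B × LowerExt R D′ B′
LowerExt-++⁻ B B′ [] _ = [] , [] , (λ ()) , (λ _ ()) , (λ _ ())
LowerExt-++⁻ B B′ (e ∷ E) RE
  with RE e (here refl) | LowerExt-++⁻ B B′ E (λ x m → RE x (there m))
... | b , b∈BB′ , Reb | D , D′ , E⊆DD′ , RDB , RD′B′ with ∈-++⁻ B b∈BB′
...   | inj₁ b∈B  = e ∷ D , D′ , ∷⁺ʳ e E⊆DD′ , LowerExt-∷⁺ b∈B Reb RDB , RD′B′
...   | inj₂ b∈B′ = D , e ∷ D′
                  , ∈-∷⁺ʳ (∈-++⁺ʳ D (here refl)) (λ m → ++⁺ʳ D (xs⊆x∷xs D′ e) (E⊆DD′ m))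
                  , RDB , LowerExt-∷⁺ b∈B′ Reb RD′B′

ideal-upperBound : ∀ {S : Set} {_≤_ : Rel S 0ℓ} → Transitive _≤_
                 → ∀ {I} → IsIdeal _≤_ I → (C : List S) → (∀ c → c ∈ C → I c)
                 → ∃[ z ] (I z × (∀ c → c ∈ C → c ≤ z))
ideal-upperBound trans (_ , (z , Iz) , _) [] _ = z , Iz , λ _ ()
ideal-upperBound trans ideal@(_ , _ , directed) (c ∷ C) IC
  with ideal-upperBound trans ideal C (λ c′ m → IC c′ (there m))
... | z′ , Iz′ , C≤z′ with directed (IC c (here refl)) Iz′
...   | z , Iz , c≤z , z′≤z = z , Iz , λ { _ (here refl) → c≤z
                                          ; x (there m) → trans (C≤z′ x m) z′≤z }

module ProximityPosetProperties (X : ProximityPoset) where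
  open ProximityPoset X public
  open IsPartialOrder isPartialOrder public
    using () renaming (refl to ≤-refl; trans to ≤-trans; reflexive to ≈⇒≤)

  ≺-ideal : ∀ a → IsIdeal _≤_ (_≺ a)
  ≺-ideal a = proj₁ (≺-lower a)

  ≤-≺-trans : ∀ {x y a} → x ≤ y → y ≺ a → x ≺ a
  ≤-≺-trans {a = a} = proj₁ (≺-ideal a)

  ≺-≤-trans : ∀ {a x y} → a ≺ x → x ≤ y → a ≺ y
  ≺-≤-trans {a} a≺x x≤y = proj₁ (≺-upper a) x≤y a≺x

  ≺-trans : ∀ {x y z} → x ≺ y → y ≺ z → x ≺ z
  ≺-trans {x} {y} {z} x≺y y≺z = proj₂ (proj₂ (≺-lower z) x) (y , x≺y , y≺z)

  ≺-interpolate : ∀ {x z} → x ≺ z → ∃[ y ] (x ≺ y × y ≺ z)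
  ≺-interpolate {x} {z} = proj₁ (proj₂ (≺-lower z) x)

module Approximable {S S′ : Set} {_≤_ _≺_ : Rel S 0ℓ} {_≤′_ _≺′_ : Rel S′ 0ℓ}
                    {r : Relation S S′}
                    (ap : IsApproximable′ _≤_ _≺_ _≤′_ _≺′_ r) where

  ideal : ∀ b → IsIdeal _≤_ (λ a → r a b)
  ideal b = proj₁ (proj₁ ap b)

  r-≤-trans : ∀ {a x y} → r a x → x ≤′ y → r a y
  r-≤-trans {a} rax x≤y = proj₁ (proj₂ ap a) x≤y rax

  ≺-r-interpolate : ∀ {a b} → r a b → ∃[ y ] (a ≺ y × r y b)
  ≺-r-interpolate {a} {b} = proj₁ (proj₂ (proj₁ ap b) a)

  ≺-r-trans : ∀ {a y b} → a ≺ y → r y b → r a b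
  ≺-r-trans {a} {y} {b} a≺y ryb = proj₂ (proj₂ (proj₁ ap b) a) (y , a≺y , ryb)

  r-≺-interpolate : ∀ {a b} → r a b → ∃[ y ] (y ≺′ b × r a y)
  r-≺-interpolate {a} {b} = proj₁ (proj₂ (proj₂ ap a) b)

  r-≺-trans : ∀ {a y b} → r a y → y ≺′ b → r a b
  r-≺-trans {a} {y} {b} ray y≺b = proj₂ (proj₂ (proj₂ ap a) b) (y , y≺b , ray)

-- A ≤ B in G(X, α) means α⁻A ⊆ α⁻B; a record, so that A and B can be inferred.
record Le {X : Set} (α : Relation X (List X)) (A B : List X) : Set where
  constructor mk≤
  field apply : ∀ x → α x A → α x B
open Le public

module Coalgebra (Cg : PLCoalgebra) where
  open PLCoalgebra Cg public
  open ProximityPosetProperties X public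
  open PL X public using (_≤L_; _≺L_)
  module α = Approximable α-approx

  _⊆α_ : List Carrier → List Carrier → Set
  C ⊆α B = ∀ c → c ∈ C → α c B

  α-⊆ : ∀ {x L M} → α x L → L ⊆ M → α x M
  α-⊆ αxL L⊆M = α.r-≤-trans αxL (λ y y∈L → y , L⊆M y∈L , ≤-refl)

  ≺⇒α : ∀ {x a A} → x ≺ a → a ∈ A → α x A
  ≺⇒α x≺a a∈A =
    let (D , αxD , D≺a) = proj₂ counit x≺a
    in α.r-≺-trans αxD (λ d d∈D → _ , a∈A , LowerExt-singleton⁻ D≺a d d∈D)

  α⇒≺ : ∀ {x a} → α x [ a ] → x ≺ a
  α⇒≺ αxa = let (D , D≺a , αxD) = α.r-≺-interpolate αxa in proj₁ counit (D , αxD , D≺a)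

  α-cut : ∀ {x E B} → α x E → E ⊆α B → α x B
  α-cut {x} {E} {B} αxE E⊆αB =
    let (D , αxD , D≺B) = proj₂ comult {x} {[ B ]} (E , αxE , λ e e∈E → B , here refl , E⊆αB e e∈E)
    in subst (α x) (++-identityʳ B) (α.r-≺-trans {b = B ++ []} αxD D≺B)

  α-factor : ∀ {x B} → α x B → (LowerExt _≺_ ⊙ α) x B
  α-factor αxB = let (L , L≺B , αxL) = α.r-≺-interpolate αxB in L , αxL , L≺B

  ≺L⇒⊆α : ∀ {E B} → E ≺L B → E ⊆α B
  ≺L⇒⊆α E≺B e e∈E = let (b , b∈B , e≺b) = E≺B e e∈E in ≺⇒α e≺b b∈B

  _≤G_ : Rel (List Carrier) 0ℓ
  _≤G_ = Le α

  _≈G_ : Rel (List Carrier) 0ℓ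
  A ≈G B = (A ≤G B) × (B ≤G A)

  ≤G-refl : ∀ {A} → A ≤G A
  ≤G-refl = mk≤ λ _ αxA → αxA

  ≤G-trans : ∀ {A B C} → A ≤G B → B ≤G C → A ≤G C
  ≤G-trans A≤B B≤C = mk≤ λ x αxA → apply B≤C x (apply A≤B x αxA)

  ⊆⇒≤G : ∀ {A B} → A ⊆ B → A ≤G B
  ⊆⇒≤G A⊆B = mk≤ λ _ αxA → α-⊆ αxA A⊆B

  []≤G : ∀ {A} → [] ≤G A
  []≤G = ⊆⇒≤G λ ()

  ≤G-cut : ∀ {A C B} → A ≤G C → C ⊆α B → A ≤G B
  ≤G-cut A≤C C⊆αB = mk≤ λ x αxA → α-cut (apply A≤C x αxA) C⊆αB

  ≤G-++ˡ : ∀ {A B} → A ≤G (A ++ B)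
  ≤G-++ˡ {A} {B} = ⊆⇒≤G (xs⊆xs++ys A B)

  ≤G-++ʳ : ∀ {A B} → B ≤G (A ++ B)
  ≤G-++ʳ {A} {B} = ⊆⇒≤G (xs⊆ys++xs B A)

  ++-lub : ∀ {A B C} → A ≤G C → B ≤G C → (A ++ B) ≤G C
  ++-lub {A} A≤C B≤C = mk≤ λ x αxAB →
    let (E , E≺AB , αxE) = α.r-≺-interpolate αxAB
    in α-cut αxE λ e e∈E →
         let (b , b∈AB , e≺b) = E≺AB e e∈E
         in [ (λ b∈A → apply A≤C e (≺⇒α e≺b b∈A))
            , (λ b∈B → apply B≤C e (≺⇒α e≺b b∈B)) ]′ (∈-++⁻ A b∈AB)

  ↓Fin : (Carrier → Set) → List Carrier → Set
  ↓Fin Q A = ∃[ C ] (A ≤G C × (∀ c → c ∈ C → Q c))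

  ↓Fin-map : ∀ {Q Q′ A} → (∀ {x} → Q x → Q′ x) → ↓Fin Q A → ↓Fin Q′ A
  ↓Fin-map Q⇒Q′ (C , A≤C , QC) = C , A≤C , λ c c∈C → Q⇒Q′ (QC c c∈C)

  ↓Fin-++ : ∀ {Q A₁ A₂} → ↓Fin Q A₁ → ↓Fin Q A₂ → ↓Fin Q (A₁ ++ A₂)
  ↓Fin-++ (C₁ , A₁≤C₁ , QC₁) (C₂ , A₂≤C₂ , QC₂) =
      C₁ ++ C₂
    , ++-lub (≤G-trans A₁≤C₁ ≤G-++ˡ) (≤G-trans A₂≤C₂ (≤G-++ʳ {C₁}))
    , λ c c∈C → [ QC₁ c , QC₂ c ]′ (∈-++⁻ C₁ c∈C)

  ↓Fin-concat : ∀ {Q} (𝒜 : List (List Carrier)) → (∀ A → A ∈ 𝒜 → ↓Fin Q A) → ↓Fin Q (concat 𝒜)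
  ↓Fin-concat [] _ = [] , ≤G-refl , λ _ ()
  ↓Fin-concat (A ∷ 𝒜) h = ↓Fin-++ (h A (here refl)) (↓Fin-concat 𝒜 λ A′ m → h A′ (there m))

  _≺G_ : Rel (List Carrier) 0ℓ
  A ≺G B = ↓Fin (λ c → α c B) A

  IsSaturated : (Carrier → Set) → Set
  IsSaturated Q = (∀ {x C} → α x C → (∀ c → c ∈ C → Q c) → Q x)
                × (∀ {x} → Q x → ∃[ L ] (α x L × (∀ y → y ∈ L → Q y)))

  ↓Fin-roundedIdeal : ∀ {Q} → IsSaturated Q → IsRoundedIdeal _≤G_ _≺G_ (↓Fin Q)
  ↓Fin-roundedIdeal {Q} (closed , split) =
      ( (λ A≤B (C , B≤C , QC) → C , ≤G-trans A≤B B≤C , QC)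
      , ([] , [] , ≤G-refl , λ _ ())
      , (λ {A₁} {A₂} QA₁ QA₂ → A₁ ++ A₂ , ↓Fin-++ QA₁ QA₂ , ≤G-++ˡ , ≤G-++ʳ {A₁}) )
    , λ A → interpolate , absorb
    where
    interpolate : ∀ {A} → ↓Fin Q A → ∃[ E ] (A ≺G E × ↓Fin Q E)
    interpolate (C , A≤C , QC) =
      let (M , C⊆αM , QM) = collect α Q α-⊆ C (λ c c∈C → split (QC c c∈C))
      in M , (C , A≤C , C⊆αM) , (M , ≤G-refl , QM)
    absorb : ∀ {A} → ∃[ E ] (A ≺G E × ↓Fin Q E) → ↓Fin Q A
    absorb (E , (C , A≤C , C⊆αE) , (D , E≤D , QD)) =
      C , A≤C , λ c c∈C → closed (apply E≤D c (C⊆αE c c∈C)) QD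

  α-saturated : ∀ B → IsSaturated (λ c → α c B)
  α-saturated B = α-cut , λ αxB → let (L , αxL , L≺B) = α-factor αxB in L , αxL , ≺L⇒⊆α L≺B

  ≺G-lower : ∀ B → IsRoundedIdeal _≤G_ _≺G_ (_≺G B)
  ≺G-lower B = ↓Fin-roundedIdeal (α-saturated B)

  ≺G-trans : ∀ {A E B} → A ≺G E → E ≺G B → A ≺G B
  ≺G-trans {A} {E} {B} A≺E E≺B = proj₂ (proj₂ (≺G-lower B) A) (E , A≺E , E≺B)

  ≺G-interpolate : ∀ {A B} → A ≺G B → ∃[ E ] (A ≺G E × E ≺G B)
  ≺G-interpolate {A} {B} = proj₁ (proj₂ (≺G-lower B) A)

  ≺G⇒≤G : ∀ {A B} → A ≺G B → A ≤G B
  ≺G⇒≤G (C , A≤C , C⊆αB) = ≤G-cut A≤C C⊆αB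

  ≺G-≤G-trans : ∀ {A B B′} → A ≺G B → B ≤G B′ → A ≺G B′
  ≺G-≤G-trans A≺B B≤B′ = ↓Fin-map (λ {c} αcB → apply B≤B′ c αcB) A≺B

  ≺L⇒≺G : ∀ {E B} → E ≺L B → E ≺G B
  ≺L⇒≺G E≺B = _ , ≤G-refl , ≺L⇒⊆α E≺B

  ≺⇒≺G : ∀ {y b} → y ≺ b → [ y ] ≺G [ b ]
  ≺⇒≺G y≺b = ≺L⇒≺G (LowerExt-singleton⁺ y≺b)

  ≺G-upper : ∀ A → IsRoundedUpper _≤G_ _≺G_ (A ≺G_)
  ≺G-upper A = (λ B≤B′ A≺B → ≺G-≤G-trans A≺B B≤B′)
             , λ B → (λ A≺B → let (E , A≺E , E≺B) = ≺G-interpolate A≺B in E , E≺B , A≺E)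
                   , (λ (E , E≺B , A≺E) → ≺G-trans A≺E E≺B)

  ↓Fin-LowerExt-++⁻ : ∀ {Y} {R : Relation Carrier Y} {A} (B₁ B₂ : List Y)
                    → ↓Fin (λ c → (LowerExt R ⊙ α) c (B₁ ++ B₂)) A
                    → ∃₂ λ D₁ D₂ → A ≤G (D₁ ++ D₂) × LowerExt R D₁ B₁ × LowerExt R D₂ B₂
  ↓Fin-LowerExt-++⁻ {R = R} B₁ B₂ (C , A≤C , RC) =
    let (M , C⊆αM , RM) = collect α (λ y → ∃[ b ] (b ∈ B₁ ++ B₂ × R y b)) α-⊆ C RC
        (D₁ , D₂ , M⊆D , RD₁ , RD₂) = LowerExt-++⁻ B₁ B₂ M RM
    in D₁ , D₂ , ≤G-trans (≤G-cut A≤C C⊆αM) (⊆⇒≤G M⊆D) , RD₁ , RD₂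

  ≺G-++⁻ : ∀ {A B B′} → A ≺G (B ++ B′) → ∃₂ λ D D′ → A ≤G (D ++ D′) × D ≺G B × D′ ≺G B′
  ≺G-++⁻ {B = B} {B′} A≺BB′ =
    let (D , D′ , A≤DD′ , D≺B , D′≺B′) = ↓Fin-LowerExt-++⁻ B B′ (↓Fin-map α-factor A≺BB′)
    in D , D′ , A≤DD′ , ≺L⇒≺G D≺B , ≺L⇒≺G D′≺B′

  Gpx : ProximityPoset
  Gpx = record
    { Carrier = List Carrier
    ; _≈_ = _≈G_
    ; _≤_ = _≤G_
    ; _≺_ = _≺G_
    ; isPartialOrder = record
        { isPreorder = record
            { isEquivalence = record
                { refl = ≤G-refl , ≤G-refl
                ; sym = λ (A≤B , B≤A) → B≤A , A≤B
                ; trans = λ (A≤B , B≤A) (B≤C , C≤B) → ≤G-trans A≤B B≤C , ≤G-trans C≤B B≤A }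
            ; reflexive = proj₁
            ; trans = ≤G-trans }
        ; antisym = _,_ }
    ; ≺-lower = ≺G-lower
    ; ≺-upper = ≺G-upper
    }

  G₀ : StrongProximityJoinSemilattice
  G₀ = record
    { px = Gpx
    ; 𝟘 = []
    ; _∨_ = _++_
    ; isBoundedJoinSemilattice = record
        { isJoinSemilattice = record
            { isPartialOrder = ProximityPoset.isPartialOrder Gpx
            ; supremum = λ A B → ≤G-++ˡ , ≤G-++ʳ {A} , λ _ → ++-lub }
        ; minimum = λ _ → []≤G }
    ; strong-𝟘 = λ A≺[] → ≺G⇒≤G A≺[] , []≤G
    ; strong-∨ = ≺G-++⁻
    }

module CoalgebraMorphism (CA CB : PLCoalgebra) (f : Relation ∣ PLCoalgebra.X CA ∣ ∣ PLCoalgebra.X CB ∣)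
                         (hf : IsCoalgHom CA CB f) where
  private
    module A = Coalgebra CA
    module B = Coalgebra CB
  module F = Approximable (proj₁ hf)

  φ : Relation A.Carrier (List B.Carrier)
  φ = B.α ⊙ f

  square : ∀ {x B′} → φ x B′ → (LowerExt f ⊙ A.α) x B′
  square = proj₁ (proj₂ hf)

  Grel : Relation (List A.Carrier) (List B.Carrier)
  Grel A′ B′ = A.↓Fin (λ c → φ c B′) A′

  f⇒φ : ∀ {x b B′} → f x b → b ∈ B′ → φ x B′
  f⇒φ fxb b∈B′ = let (y , y≺b , fxy) = F.r-≺-interpolate fxb in y , fxy , B.≺⇒α y≺b b∈B′

  φ[]⇒f : ∀ {x y} → φ x [ y ] → f x y
  φ[]⇒f (y₁ , fxy₁ , βy₁y) = F.r-≺-trans fxy₁ (B.α⇒≺ βy₁y)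

  LowerExt⇒φ : ∀ {L B′} → LowerExt f L B′ → ∀ y → y ∈ L → φ y B′
  LowerExt⇒φ fLB′ y y∈L = let (b , b∈B′ , fyb) = fLB′ y y∈L in f⇒φ fyb b∈B′

  LowerExt⇒Grel : ∀ {D B′} → LowerExt f D B′ → Grel D B′
  LowerExt⇒Grel fDB′ = _ , A.≤G-refl , LowerExt⇒φ fDB′

  φ-≤G-trans : ∀ {x B′ B″} → φ x B′ → B′ B.≤G B″ → φ x B″
  φ-≤G-trans (y , fxy , βyB′) B′≤B″ = y , fxy , apply B′≤B″ y βyB′

  φ-⊆ : ∀ {x B′ B″} → φ x B′ → B′ ⊆ B″ → φ x B″
  φ-⊆ φxB′ B′⊆B″ = φ-≤G-trans φxB′ (B.⊆⇒≤G B′⊆B″)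

  φ-cut : ∀ {x C B′} → A.α x C → (∀ c → c ∈ C → φ c B′) → φ x B′
  φ-cut {C = C} {B′} αxC φCB′ =
    let (M , fCM , M⊆βB′) =
          collect (λ c M → ∃[ y ] (y ∈ M × f c y)) (λ y → B.α y B′)
                  (λ (y , y∈L , fcy) L⊆M → y , L⊆M y∈L , fcy) C
                  (λ c c∈C → let (y , fcy , βyB′) = φCB′ c c∈C
                             in [ y ] , (y , here refl , fcy) , all-singleton βyB′)
        (y , fxy , βyM) = proj₂ (proj₂ hf) (C , αxC , fCM)
    in y , fxy , B.α-cut βyM M⊆βB′

  φ-saturated : ∀ B′ → A.IsSaturated (λ c → φ c B′)
  φ-saturated B′ = φ-cut , λ φxB′ → let (L , αxL , fLB′) = square φxB′ in L , αxL , LowerExt⇒φ fLB′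

  Grel-upper : ∀ A′ → IsRoundedUpper B._≤G_ B._≺G_ (Grel A′)
  Grel-upper A′ = (λ B′≤B″ → A.↓Fin-map λ φcB′ → φ-≤G-trans φcB′ B′≤B″)
                , λ B′ → interpolate
                       , λ (E , E≺B′ , A′E) → A.↓Fin-map (λ φcE → φ-≤G-trans φcE (B.≺G⇒≤G E≺B′)) A′E
    where
    interpolate : ∀ {B′} → Grel A′ B′ → ∃[ E ] (E B.≺G B′ × Grel A′ E)
    interpolate {B′} (C , A′≤C , φCB′) =
      let (M , φCM , M⊆βB′) =
            collect φ (λ y → B.α y B′) φ-⊆ C
                    (λ c c∈C → let (y , fcy , βyB′) = φCB′ c c∈C
                                   (L , L≺B′ , βyL) = B.α.r-≺-interpolate βyB′
                               in L , (y , fcy , βyL) , B.≺L⇒⊆α L≺B′)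
      in M , (M , B.≤G-refl , M⊆βB′) , (C , A′≤C , φCM)

  Grel-join : IsJoinApproximable A.G₀ B.G₀ Grel
  Grel-join = zero , join
    where
    zero : ∀ {A′} → Grel A′ [] → A′ A.≈G []
    zero (C , A′≤C , φC[]) =
        A.≤G-cut A′≤C (λ c c∈C → let (L , αcL , fL[]) = square (φC[] c c∈C)
                                 in A.α-⊆ αcL (LowerExt-[]⁻ fL[]))
      , A.[]≤G
    join : ∀ {A′ B₁ B₂} → Grel A′ (B₁ ++ B₂)
         → ∃₂ λ D₁ D₂ → A′ A.≤G (D₁ ++ D₂) × Grel D₁ B₁ × Grel D₂ B₂
    join {B₁ = B₁} {B₂} A′B =
      let (D₁ , D₂ , A′≤D , fD₁ , fD₂) = A.↓Fin-LowerExt-++⁻ B₁ B₂ (A.↓Fin-map square A′B)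
      in D₁ , D₂ , A′≤D , LowerExt⇒Grel fD₁ , LowerExt⇒Grel fD₂

  Grel-hom : IsSPxJLatHom A.G₀ B.G₀ Grel
  Grel-hom = ((λ B′ → A.↓Fin-roundedIdeal (φ-saturated B′)) , Grel-upper) , Grel-join

Grel-resp : ∀ {CA CB f g} (hf : IsCoalgHom CA CB f) (hg : IsCoalgHom CA CB g)
          → f ≃R g → CoalgebraMorphism.Grel CA CB f hf ≃R CoalgebraMorphism.Grel CA CB g hg
Grel-resp {CA} _ _ (f⊆g , g⊆f) =
    A.↓Fin-map (λ (y , fxy , βy) → y , f⊆g fxy , βy)
  , A.↓Fin-map (λ (y , gxy , βy) → y , g⊆f gxy , βy)
  where module A = Coalgebra CA

Grel-id : ∀ {CA} (h : IsCoalgHom CA CA (ProximityPoset._≺_ (PLCoalgebra.X CA)))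
        → CoalgebraMorphism.Grel CA CA _ h ≃R Coalgebra._≺G_ CA
Grel-id {CA} _ =
    A.↓Fin-map (λ (y , x≺y , αy) → A.α.≺-r-trans x≺y αy)
  , A.↓Fin-map (λ αx → let (y , x≺y , αy) = A.α.≺-r-interpolate αx in y , x≺y , αy)
  where module A = Coalgebra CA

Grel-∘ : ∀ {CA CB CC f g} (hf : IsCoalgHom CA CB f) (hg : IsCoalgHom CB CC g) (hgf : IsCoalgHom CA CC (g ⊙ f))
       → CoalgebraMorphism.Grel CA CC (g ⊙ f) hgf
           ≃R (CoalgebraMorphism.Grel CB CC g hg ⊙ CoalgebraMorphism.Grel CA CB f hf)
Grel-∘ {CA} {CB} {CC} {f} {g} hf hg hgf = split , join
  where
  module F = CoalgebraMorphism CA CB f hf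
  module G = CoalgebraMorphism CB CC g hg
  module GF = CoalgebraMorphism CA CC (g ⊙ f) hgf
  split : ∀ {A′ Z} → GF.Grel A′ Z → (G.Grel ⊙ F.Grel) A′ Z
  split {Z = Z} (C , A′≤C , φCZ) =
    let (M , φCM , M⊆φZ) =
          collect F.φ (λ y → G.φ y Z) F.φ-⊆ C
                  (λ c c∈C → let (z , (y , fcy , gyz) , γzZ) = φCZ c c∈C
                             in [ y ] , F.f⇒φ fcy (here refl) , all-singleton (z , gyz , γzZ))
    in M , (C , A′≤C , φCM) , (M , Coalgebra.≤G-refl CB , M⊆φZ)
  join : ∀ {A′ Z} → (G.Grel ⊙ F.Grel) A′ Z → GF.Grel A′ Z
  join (M , (C , A′≤C , φCM) , (D , M≤D , φDZ)) =
    C , A′≤C , λ c c∈C → let (y , fcy , βyM) = φCM c c∈C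
                             (z , gyz , γzZ) = G.φ-cut (apply M≤D y βyM) φDZ
                         in z , (y , fcy , gyz) , γzZ

Gfun : Functor CoAlgPL SPxJLat
Gfun = record
  { F₀ = Coalgebra.G₀
  ; F₁ = λ {CA} {CB} (f , hf) →
      CoalgebraMorphism.Grel CA CB f hf , CoalgebraMorphism.Grel-hom CA CB f hf
  ; F-resp = λ {CA} {CB} {f} {g} → Grel-resp {CA} {CB} (proj₂ f) (proj₂ g)
  ; F-id = λ {CA} → Grel-id {CA} (proj₂ (Category.id CoAlgPL {CA}))
  ; F-∘ = λ {CA} {CB} {CC} {f} {g} →
      Grel-∘ {CA} {CB} {CC} (proj₂ f) (proj₂ g) (proj₂ (Category._∘_ CoAlgPL {CA} {CB} {CC} g f))
  }

module JoinSemilatticeProperties (S : StrongProximityJoinSemilattice) where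
  open StrongProximityJoinSemilattice S public
  open ProximityPosetProperties px public
  open PL px public using (_≤L_; _≺L_)
  private module BJ = IsBoundedJoinSemilattice isBoundedJoinSemilattice

  x≤x∨y : ∀ {x y} → x ≤ (x ∨ y)
  x≤x∨y = BJ.x≤x∨y _ _

  y≤x∨y : ∀ {x y} → y ≤ (x ∨ y)
  y≤x∨y = BJ.y≤x∨y _ _

  ∨-least : ∀ {x y z} → x ≤ z → y ≤ z → (x ∨ y) ≤ z
  ∨-least = BJ.∨-least

  ∨-mono : ∀ {x y x′ y′} → x ≤ x′ → y ≤ y′ → (x ∨ y) ≤ (x′ ∨ y′)
  ∨-mono x≤x′ y≤y′ = ∨-least (≤-trans x≤x′ x≤x∨y) (≤-trans y≤y′ y≤x∨y)

  ⋁ : List Carrier → Carrier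
  ⋁ = foldr _∨_ 𝟘

  ∈⇒≤⋁ : ∀ {a A} → a ∈ A → a ≤ ⋁ A
  ∈⇒≤⋁ (here refl) = x≤x∨y
  ∈⇒≤⋁ (there a∈A) = ≤-trans (∈⇒≤⋁ a∈A) y≤x∨y

  ⋁-lub : ∀ {z} A → (∀ a → a ∈ A → a ≤ z) → ⋁ A ≤ z
  ⋁-lub [] _ = BJ.minimum _
  ⋁-lub (a ∷ A) A≤z = ∨-least (A≤z a (here refl)) (⋁-lub A λ x m → A≤z x (there m))

  ⋁-mono : ∀ {A B} → A ≤L B → ⋁ A ≤ ⋁ B
  ⋁-mono {A} A≤B = ⋁-lub A λ a a∈A → let (b , b∈B , a≤b) = A≤B a a∈A in ≤-trans a≤b (∈⇒≤⋁ b∈B)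

  ⋁-⊆ : ∀ {A B} → A ⊆ B → ⋁ A ≤ ⋁ B
  ⋁-⊆ A⊆B = ⋁-mono λ a a∈A → a , A⊆B a∈A , ≤-refl

  ⋁-++ : ∀ B B′ → ⋁ (B ++ B′) ≤ (⋁ B ∨ ⋁ B′)
  ⋁-++ B B′ = ⋁-lub (B ++ B′) λ a a∈BB′ →
    [ (λ a∈B → ≤-trans (∈⇒≤⋁ a∈B) x≤x∨y)
    , (λ a∈B′ → ≤-trans (∈⇒≤⋁ a∈B′) y≤x∨y) ]′ (∈-++⁻ B a∈BB′)

  x≤⋁[x] : ∀ {x} → x ≤ ⋁ [ x ]
  x≤⋁[x] = x≤x∨y

  ideal-⋁ : ∀ {I} → IsIdeal _≤_ I → ∀ A → (∀ a → a ∈ A → I a) → I (⋁ A)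
  ideal-⋁ ideal A IA =
    let (z , Iz , A≤z) = ideal-upperBound ≤-trans ideal A IA in proj₁ ideal (⋁-lub A A≤z) Iz

  ≺-⋁ : ∀ {A x} → (∀ a → a ∈ A → a ≺ x) → ⋁ A ≺ x
  ≺-⋁ {A} {x} = ideal-⋁ (≺-ideal x) A

module _ (S T : StrongProximityJoinSemilattice) where
  private
    module S = JoinSemilatticeProperties S
    module T = JoinSemilatticeProperties T

  ⋁-decompose : ∀ {R} → IsJoinApproximable S T R
              → ∀ {x} B → R x (T.⋁ B) → ∃[ A ] (x S.≤ S.⋁ A × LowerExt R A B)
  ⋁-decompose (R𝟘 , _) [] Rx𝟘 = [] , S.≈⇒≤ (R𝟘 Rx𝟘) , λ _ ()
  ⋁-decompose R-join@(_ , R∨) (b ∷ B) Rxb∨⋁B =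
    let (b′ , c′ , x≤b′∨c′ , Rb′b , Rc′⋁B) = R∨ {b = b} {c = T.⋁ B} Rxb∨⋁B
        (A , c′≤⋁A , RAB) = ⋁-decompose R-join B Rc′⋁B
    in b′ ∷ A
       , S.≤-trans x≤b′∨c′ (S.∨-mono S.≤-refl c′≤⋁A)
       , LowerExt-∷⁺ (here refl) Rb′b (LowerExt-⊆ʳ there RAB)

module FreeCoalgebra (S : StrongProximityJoinSemilattice) where
  open JoinSemilatticeProperties S

  α : Relation Carrier (List Carrier)
  α a A = a ≺ ⋁ A

  ≺-joinApproximable : IsJoinApproximable S S _≺_
  ≺-joinApproximable = strong-𝟘 , strong-∨

  ⋁-≺L : ∀ {E A} → E ≺L A → ⋁ E ≺ ⋁ A
  ⋁-≺L E≺A = ≺-⋁ λ e e∈E → let (b , b∈A , e≺b) = E≺A e e∈E in ≺-≤-trans e≺b (∈⇒≤⋁ b∈A)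

  α-approx : IsApproximable′ _≤_ _≺_ _≤L_ _≺L_ α
  α-approx = (λ B → ≺-lower (⋁ B))
           , λ a → (λ A≤A′ a≺⋁A → ≺-≤-trans a≺⋁A (⋁-mono A≤A′))
                 , λ A → interpolate , λ (E , E≺A , a≺⋁E) → ≺-trans a≺⋁E (⋁-≺L E≺A)
    where
    interpolate : ∀ {a A} → α a A → ∃[ E ] (E ≺L A × α a E)
    interpolate {A = A} a≺⋁A =
      let (c , a≺c , c≺⋁A) = ≺-interpolate a≺⋁A
          (E , c≤⋁E , E≺A) = ⋁-decompose S S ≺-joinApproximable A c≺⋁A
      in E , E≺A , ≺-≤-trans a≺c c≤⋁E

  counit′ : (PL.ε px ⊙ α) ≃R _≺_
  counit′ = (λ (A , a≺⋁A , A≺b) → ≺-trans a≺⋁A (≺-⋁ (LowerExt-singleton⁻ A≺b)))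
          , λ a≺b → let (y , a≺y , y≺b) = ≺-interpolate a≺b
                    in [ y ] , ≺-≤-trans a≺y x≤⋁[x] , LowerExt-singleton⁺ y≺b

  comult′ : (PL.ν px ⊙ α) ≃R (LowerExt α ⊙ α)
  comult′ = split , join
    where
    split : ∀ {a 𝒰} → (PL.ν px ⊙ α) a 𝒰 → (LowerExt α ⊙ α) a 𝒰
    split {𝒰 = 𝒰} (A , a≺⋁A , A≺⋃𝒰) = A , a≺⋁A , λ x x∈A →
      let (u , u∈⋃𝒰 , x≺u) = A≺⋃𝒰 x x∈A
          (U , u∈U , U∈𝒰) = ∈-concat⁻′ 𝒰 u∈⋃𝒰
      in U , U∈𝒰 , ≺-≤-trans x≺u (∈⇒≤⋁ u∈U)
    join : ∀ {a 𝒰} → (LowerExt α ⊙ α) a 𝒰 → (PL.ν px ⊙ α) a 𝒰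
    join {𝒰 = 𝒰} (B , a≺⋁B , Bα𝒰) =
      let (M , B≤⋁M , M≺⋃𝒰) =
            collect (λ b M → b ≤ ⋁ M) (λ y → ∃[ u ] (u ∈ concat 𝒰 × y ≺ u))
                    (λ b≤⋁L L⊆M → ≤-trans b≤⋁L (⋁-⊆ L⊆M)) B
                    (λ b b∈B → let (U , U∈𝒰 , b≺⋁U) = Bα𝒰 b b∈B
                                   (C , b≤⋁C , C≺U) = ⋁-decompose S S ≺-joinApproximable U b≺⋁U
                               in C , b≤⋁C , λ y y∈C → let (u , u∈U , y≺u) = C≺U y y∈C
                                                      in u , ∈-concat⁺′ u∈U U∈𝒰 , y≺u)
      in M , ≺-≤-trans a≺⋁B (⋁-lub B B≤⋁M) , M≺⋃𝒰

  F₀ : PLCoalgebra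
  F₀ = record { X = px ; α = α ; α-approx = α-approx ; counit = counit′ ; comult = comult′ }

module _ (S T : StrongProximityJoinSemilattice)
         (r : Relation ∣ StrongProximityJoinSemilattice.px S ∣ ∣ StrongProximityJoinSemilattice.px T ∣)
         (hr : IsSPxJLatHom S T r) where
  private
    module S = JoinSemilatticeProperties S
    module T = JoinSemilatticeProperties T
    module R = Approximable (proj₁ hr)

  joinApproximable⇒coalgebraHom : IsCoalgHom (FreeCoalgebra.F₀ S) (FreeCoalgebra.F₀ T) r
  joinApproximable⇒coalgebraHom = proj₁ hr , split , join
    where
    split : ∀ {a B} → (FreeCoalgebra.α T ⊙ r) a B → (LowerExt r ⊙ FreeCoalgebra.α S) a B
    split {B = B} (b , rab , b≺⋁B) =
      let (a′ , a≺a′ , ra′b) = R.≺-r-interpolate rab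
          (A , a′≤⋁A , rAB) = ⋁-decompose S T (proj₂ hr) B (R.r-≺-trans ra′b b≺⋁B)
      in A , S.≺-≤-trans a≺a′ a′≤⋁A , rAB
    join : ∀ {a B} → (LowerExt r ⊙ FreeCoalgebra.α S) a B → (FreeCoalgebra.α T ⊙ r) a B
    join {B = B} (A , a≺⋁A , rAB) =
      let r⋁A⋁B = S.ideal-⋁ (R.ideal (T.⋁ B)) A λ x x∈A →
                    let (b , b∈B , rxb) = rAB x x∈A in R.r-≤-trans rxb (T.∈⇒≤⋁ b∈B)
          (y , y≺⋁B , ray) = R.r-≺-interpolate (R.≺-r-trans a≺⋁A r⋁A⋁B)
      in y , ray , y≺⋁B

Ffun : Functor SPxJLat CoAlgPL
Ffun = record
  { F₀ = FreeCoalgebra.F₀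
  ; F₁ = λ {S} {T} (r , hr) → r , joinApproximable⇒coalgebraHom S T r hr
  ; F-resp = λ r≃s → r≃s
  ; F-id = (λ p → p) , (λ p → p)
  ; F-∘ = (λ p → p) , (λ p → p)
  }

module Unit (S : StrongProximityJoinSemilattice) where
  open JoinSemilatticeProperties S
  open FreeCoalgebra S using (α; F₀)
  private module GF = Coalgebra F₀

  η : Relation Carrier (List Carrier)
  η = α

  η⁻ : Relation (List Carrier) Carrier
  η⁻ A a = GF.↓Fin (_≺ a) A

  ≺-saturated : ∀ a → GF.IsSaturated (_≺ a)
  ≺-saturated a = (λ x≺⋁C C≺a → ≺-trans x≺⋁C (≺-⋁ C≺a))
                , λ x≺a → let (y , x≺y , y≺a) = ≺-interpolate x≺a
                          in [ y ] , ≺-≤-trans x≺y x≤⋁[x] , all-singleton y≺a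

  η-hom : IsSPxJLatHom S GF.G₀ η
  η-hom = ( (λ B → ≺-lower (⋁ B))
          , λ a → (λ A≤A′ a≺⋁A → apply A≤A′ a a≺⋁A) , λ A → interpolate {a} {A} , absorb {a} {A} )
        , strong-𝟘 , λ {_} {B} {B′} a≺⋁BB′ → strong-∨ (≺-≤-trans a≺⋁BB′ (⋁-++ B B′))
    where
    interpolate : ∀ {a A} → η a A → ∃[ E ] (E GF.≺G A × η a E)
    interpolate a≺⋁A = let (y , a≺y , y≺⋁A) = ≺-interpolate a≺⋁A
                       in [ y ] , ([ y ] , GF.≤G-refl , all-singleton y≺⋁A) , ≺-≤-trans a≺y x≤⋁[x]
    absorb : ∀ {a A} → ∃[ E ] (E GF.≺G A × η a E) → η a A
    absorb {a} (E , (C , E≤C , C≺⋁A) , a≺⋁E) = ≺-trans (apply E≤C a a≺⋁E) (≺-⋁ C≺⋁A)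

  η⁻-hom : IsSPxJLatHom GF.G₀ S η⁻
  η⁻-hom = ((λ a → GF.↓Fin-roundedIdeal (≺-saturated a)) , upper) , zero , join
    where
    upper : ∀ A → IsRoundedUpper _≤_ _≺_ (η⁻ A)
    upper A = (λ a≤a′ → GF.↓Fin-map λ c≺a → ≺-≤-trans c≺a a≤a′)
            , λ a → interpolate , λ (y , y≺a , Ay) → GF.↓Fin-map (λ c≺y → ≺-trans c≺y y≺a) Ay
      where
      interpolate : ∀ {a} → η⁻ A a → ∃[ y ] (y ≺ a × η⁻ A y)
      interpolate (C , A≤C , C≺a) =
        let (y , ⋁C≺y , y≺a) = ≺-interpolate (≺-⋁ C≺a)
        in y , y≺a , (C , A≤C , λ c c∈C → ≤-≺-trans (∈⇒≤⋁ c∈C) ⋁C≺y)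
    zero : ∀ {A} → η⁻ A 𝟘 → A GF.≈G []
    zero (C , A≤C , C≺𝟘) =
      mk≤ (λ x x≺⋁A → ≺-≤-trans (apply A≤C x x≺⋁A) (≈⇒≤ (strong-𝟘 (≺-⋁ C≺𝟘)))) , GF.[]≤G
    join : ∀ {A b c} → η⁻ A (b ∨ c) → ∃₂ λ B C → A GF.≤G (B ++ C) × η⁻ B b × η⁻ C c
    join (C , A≤C , C≺b∨c) =
      let (b′ , c′ , ⋁C≤b′∨c′ , b′≺b , c′≺c) = strong-∨ (≺-⋁ C≺b∨c)
      in [ b′ ] , [ c′ ]
         , mk≤ (λ x x≺⋁A → ≺-≤-trans (apply A≤C x x≺⋁A) (≤-trans ⋁C≤b′∨c′ (∨-mono ≤-refl x≤⋁[x])))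
         , ([ b′ ] , GF.≤G-refl , all-singleton b′≺b) , ([ c′ ] , GF.≤G-refl , all-singleton c′≺c)

  isoˡ : (η⁻ ⊙ η) ≃R _≺_
  isoˡ = (λ {a} (A , a≺⋁A , (C , A≤C , C≺b)) → ≺-trans (apply A≤C a a≺⋁A) (≺-⋁ C≺b))
       , λ a≺b → let (y , a≺y , y≺b) = ≺-interpolate a≺b
                 in [ y ] , ≺-≤-trans a≺y x≤⋁[x] , ([ y ] , GF.≤G-refl , all-singleton y≺b)

  isoʳ : (η ⊙ η⁻) ≃R GF._≺G_
  isoʳ = (λ (a , Aa , a≺⋁B) → GF.↓Fin-map (λ c≺a → ≺-trans c≺a a≺⋁B) Aa)
       , λ (C , A≤C , C≺⋁B) → let (y , ⋁C≺y , y≺⋁B) = ≺-interpolate (≺-⋁ C≺⋁B)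
                              in y , (C , A≤C , λ c c∈C → ≤-≺-trans (∈⇒≤⋁ c∈C) ⋁C≺y) , y≺⋁B

unit-natural : ∀ {S T}
               (r : Relation ∣ StrongProximityJoinSemilattice.px S ∣ ∣ StrongProximityJoinSemilattice.px T ∣)
               (hr : IsSPxJLatHom S T r)
             → (Unit.η T ⊙ r) ≃R (CoalgebraMorphism.Grel (FreeCoalgebra.F₀ S) (FreeCoalgebra.F₀ T) r
                                                        (joinApproximable⇒coalgebraHom S T r hr) ⊙ Unit.η S)
unit-natural {S} {T} r hr = (λ {a} {B} → to {a} {B}) , (λ {a} {B} → from {a} {B})
  where
  module S = JoinSemilatticeProperties S
  module T = JoinSemilatticeProperties T
  module R = Approximable (proj₁ hr)
  module H = CoalgebraMorphism (FreeCoalgebra.F₀ S) (FreeCoalgebra.F₀ T) r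
                               (joinApproximable⇒coalgebraHom S T r hr)
  to : ∀ {a B} → (Unit.η T ⊙ r) a B → (H.Grel ⊙ Unit.η S) a B
  to (b , rab , b≺⋁B) =
    let (a′ , a≺a′ , ra′b) = R.≺-r-interpolate rab
    in [ a′ ] , S.≺-≤-trans a≺a′ S.x≤⋁[x] , ([ a′ ] , mk≤ (λ _ p → p) , all-singleton (b , ra′b , b≺⋁B))
  from : ∀ {a B} → (H.Grel ⊙ Unit.η S) a B → (Unit.η T ⊙ r) a B
  from {a} {B} (A , a≺⋁A , (C , A≤C , φCB)) =
    let r⋁C⋁B = S.ideal-⋁ (R.ideal (T.⋁ B)) C λ c c∈C →
                  let (y , rcy , y≺⋁B) = φCB c c∈C in R.r-≺-trans rcy y≺⋁B
        (y , y≺⋁B , ray) = R.r-≺-interpolate (R.≺-r-trans (apply A≤C a a≺⋁A) r⋁C⋁B)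
    in y , ray , y≺⋁B

module Counit (Cg : PLCoalgebra) where
  open Coalgebra Cg
  private module FG = Coalgebra (FreeCoalgebra.F₀ G₀)

  ε : Relation (List Carrier) Carrier
  ε A b = A ≺G [ b ]

  ε⁻ : Relation Carrier (List Carrier)
  ε⁻ = α

  ≺G-[_] : ∀ {A C} b → A ≤G C → (∀ c → c ∈ C → c ≺ b) → A ≺G [ b ]
  ≺G-[ b ] A≤C C≺b = _ , A≤C , λ c c∈C → ≺⇒α (C≺b c c∈C) (here refl)

  α⇒[]≤G : ∀ {b B} → α b B → [ b ] ≤G B
  α⇒[]≤G αbB = mk≤ λ x αx[b] → α-cut αx[b] (all-singleton αbB)

  isoˡ : (ε⁻ ⊙ ε) ≃R _≺G_
  isoˡ = (λ (b , A≺[b] , αbB) → ≺G-≤G-trans A≺[b] (α⇒[]≤G αbB)) , join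
    where
    join : ∀ {A B} → A ≺G B → (α ⊙ ε) A B
    join {B = B} (C , A≤C , C⊆αB) =
      let (z , αzB , C≤z) = ideal-upperBound ≤-trans (α.ideal B) C C⊆αB
          (b , z≺b , αbB) = α.≺-r-interpolate αzB
      in b , ≺G-[ b ] A≤C (λ c c∈C → ≤-≺-trans (C≤z c c∈C) z≺b) , αbB

  isoʳ : (ε ⊙ ε⁻) ≃R _≺_
  isoʳ = (λ {a} (A , αaA , A≺[b]) → α⇒≺ (apply (≺G⇒≤G A≺[b]) a αaA))
       , λ a≺b → let (y , a≺y , y≺b) = ≺-interpolate a≺b
                 in [ y ] , ≺⇒α a≺y (here refl) , ≺⇒≺G y≺b

  ε-approx : IsApproximable Gpx X ε
  ε-approx = (λ b → ≺G-lower [ b ])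
           , λ A → (λ b≤b′ A≺[b] →
                      ≺G-≤G-trans A≺[b] (mk≤ λ _ αx[b] → α.r-≤-trans αx[b] (LowerExt-singleton⁺ b≤b′)))
                 , λ b → interpolate , λ (y , y≺b , A≺[y]) → ≺G-trans A≺[y] (≺⇒≺G y≺b)
    where
    interpolate : ∀ {A b} → A ≺G [ b ] → ∃[ y ] (y ≺ b × A ≺G [ y ])
    interpolate {b = b} (C , A≤C , C⊆α[b]) =
      let (z , z≺b , C≤z) = ideal-upperBound ≤-trans (≺-ideal b) C λ c c∈C → α⇒≺ (C⊆α[b] c c∈C)
          (y , z≺y , y≺b) = ≺-interpolate z≺b
      in y , y≺b , ≺G-[ y ] A≤C (λ c c∈C → ≤-≺-trans (C≤z c c∈C) z≺y)

  -- FG.α A 𝒜 is A ≺G concat 𝒜, since ⋁ in G(X, α) is concat.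
  ε-square : (α ⊙ ε) ≃R (LowerExt ε ⊙ FG.α)
  ε-square = split , join
    where
    split : ∀ {A B} → (α ⊙ ε) A B → (LowerExt ε ⊙ FG.α) A B
    split {A} {B} p =
      let (C , A≤C , C⊆αB) = proj₁ isoˡ p
          (M , C⊆αM , M≺B) = collect α (λ y → ∃[ b ] (b ∈ B × y ≺ b)) α-⊆ C
                                     (λ c c∈C → α-factor (C⊆αB c c∈C))
      in map [_] M
         , subst (A ≺G_) (sym (concat-map-[_] M)) (C , A≤C , C⊆αM)
         , λ U U∈ → let (y , y∈M , U≡[y]) = ∈-map⁻ [_] U∈
                        (b , b∈B , y≺b) = M≺B y y∈M
                    in b , b∈B , subst (_≺G [ b ]) (sym U≡[y]) (≺⇒≺G y≺b)
    join : ∀ {A B} → (LowerExt ε ⊙ FG.α) A B → (α ⊙ ε) A B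
    join (𝒜 , A≺⋃𝒜 , 𝒜εB) =
      proj₂ isoˡ (≺G-trans A≺⋃𝒜 (↓Fin-concat 𝒜 λ U U∈𝒜 →
        let (b , b∈B , U≺[b]) = 𝒜εB U U∈𝒜 in ≺G-≤G-trans U≺[b] (⊆⇒≤G λ { (here refl) → b∈B })))

  ε⁻-approx : IsApproximable X Gpx ε⁻
  ε⁻-approx = proj₁ α-approx
            , λ b → (λ A≤A′ αbA → apply A≤A′ b αbA)
                  , λ A → (λ αbA → let (E , E≺A , αbE) = α.r-≺-interpolate αbA in E , ≺L⇒≺G E≺A , αbE)
                        , λ (E , E≺A , αbE) → apply (≺G⇒≤G E≺A) b αbE

  ε⁻-square : (FG.α ⊙ ε⁻) ≃R (LowerExt ε⁻ ⊙ α)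
  ε⁻-square = (λ {b} (A , αbA , A≺⋃𝒜) →
                 let (E , E≺⋃𝒜 , αbE) = α.r-≺-interpolate (apply (≺G⇒≤G A≺⋃𝒜) b αbA)
                                       in proj₁ comult (E , αbE , E≺⋃𝒜))
            , λ p → let (E , αbE , E≺⋃𝒜) = proj₂ comult p in E , αbE , ≺L⇒≺G E≺⋃𝒜

counit-natural : ∀ {CA CB} (f : Relation ∣ PLCoalgebra.X CA ∣ ∣ PLCoalgebra.X CB ∣)
                 (hf : IsCoalgHom CA CB f)
               → (Counit.ε CB ⊙ CoalgebraMorphism.Grel CA CB f hf) ≃R (f ⊙ Counit.ε CA)
counit-natural {CA} {CB} f hf = to , from
  where
  module A = Counit CA
  module B = Coalgebra CB
  module H = CoalgebraMorphism CA CB f hf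
  open Coalgebra CA using (≤-trans; ≤-≺-trans)
  to : ∀ {A y} → (Counit.ε CB ⊙ H.Grel) A y → (f ⊙ A.ε) A y
  to {y = y} (B′ , (C , A≤C , φCB′) , B′≺[y]) =
    let (z , fzy , C≤z) = ideal-upperBound ≤-trans (H.F.ideal y) C λ c c∈C →
                              H.φ[]⇒f (H.φ-≤G-trans (φCB′ c c∈C) (B.≺G⇒≤G B′≺[y]))
        (x , z≺x , fxy) = H.F.≺-r-interpolate fzy
    in x , A.≺G-[ x ] A≤C (λ c c∈C → ≤-≺-trans (C≤z c c∈C) z≺x) , fxy
  from : ∀ {A y} → (f ⊙ A.ε) A y → (Counit.ε CB ⊙ H.Grel) A y
  from (x , (C , A≤C , C⊆α[x]) , fxy) =
    let (y′ , y′≺y , fxy′) = H.F.r-≺-interpolate fxy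
    in [ y′ ] , (C , A≤C , λ c c∈C → H.φ-cut (C⊆α[x] c c∈C) (all-singleton (H.f⇒φ fxy′ (here refl))))
       , B.≺⇒≺G y′≺y

theorem3p30 : Equivalence SPxJLat CoAlgPL
theorem3p30 = record
  { F = Ffun
  ; G = Gfun
  ; unit = record
      { η = λ S → Unit.η S , Unit.η-hom S
      ; η⁻¹ = λ S → Unit.η⁻ S , Unit.η⁻-hom S
      ; isoˡ = Unit.isoˡ
      ; isoʳ = Unit.isoʳ
      ; natural = λ {S} {T} (r , hr) → unit-natural {S} {T} r hr
      }
  ; counit = record
      { η = λ C → Counit.ε C , Counit.ε-approx C , Counit.ε-square C
      ; η⁻¹ = λ C → Counit.ε⁻ C , Counit.ε⁻-approx C , Counit.ε⁻-square C
      ; isoˡ = Counit.isoˡ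
      ; isoʳ = Counit.isoʳ
      ; natural = λ {CA} {CB} (f , hf) → counit-natural {CA} {CB} f hf
      }
  }
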